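{- Let $m,n\geq 2$, $X=\{1,2,\ldots,m\}$, $Y=\{\bar1,\ldots,\bar n\}$ (disjoint), and $k$ an integer with $0<k<m+n-2$. Let $\mathcal F_{X,Y}^k$ be the set of forests with vertex set $X\sqcup Y$ with exactly $k$ connected components all of whose edges join $X$ to $Y$. Let $P$, $Q$, $R$ be the sets of $F\in\mathcal F_{X,Y}^k$ containing the edges $\{1,\bar1\},\{1,\bar2\}$, resp. $\{1,\bar1\},\{\bar1,2\}$, resp. $\{1,\bar1\},\{2,\bar2\}$. Then $\#R<\#P+\#Q$.
   Context: A forest is an acyclic graph; here a spanning acyclic subgraph of the complete bipartite graph $K_{X,Y}$, whose edges are the sets $\{x,y\}$, $x\in X$, $y\in Y$. -}

module Defs where

open import Data.Nat using (ℕ; suc)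
open import Data.Fin using (Fin; zero; suc)
open import Data.Bool using (Bool; true)
open import Data.Vec using (Vec; lookup)
open import Data.List using (List; []; _∷_; length)
open import Data.Sum using (_⊎_; inj₁; inj₂)
open import Data.Product using (Σ; ∃; _×_)
open import Data.Empty using (⊥)
open import Data.Nat using (_≤_)
open import Relation.Nullary using (¬_)
open import Relation.Binary.PropositionalEquality using (_≡_)
open import Relation.Binary.Construct.Closure.ReflexiveTransitive using (Star)
open import Data.List.Relation.Unary.Unique.Propositional using (Unique)
open import Data.List.Membership.Propositional using (_∈_)
open import Function.Bundles using (_⇔_)

-- Vertex set X ⊔ Y with X = Fin m (1 ↦ zero, 2 ↦ suc zero), Y = Fin n (1̄ ↦ zero, 2̄ ↦ suc zero).
V : ℕ → ℕ → Set
V m n = Fin m ⊎ Fin n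

-- A spanning subgraph of K_{X,Y}: E[x][y] = true iff {x, ȳ} is an edge.
EdgeSet : ℕ → ℕ → Set
EdgeSet m n = Vec (Vec Bool n) m

HasEdge : ∀ {m n} → EdgeSet m n → Fin m → Fin n → Set
HasEdge E x y = lookup (lookup E x) y ≡ true

Adj : ∀ {m n} → EdgeSet m n → V m n → V m n → Set
Adj E (inj₁ x) (inj₂ y) = HasEdge E x y
Adj E (inj₂ y) (inj₁ x) = HasEdge E x y
Adj E (inj₁ _) (inj₁ _) = ⊥
Adj E (inj₂ _) (inj₂ _) = ⊥

Chain : ∀ {m n} → EdgeSet m n → V m n → List (V m n) → V m n → Set
Chain E a [] b = Adj E a b
Chain E a (v ∷ vs) b = Adj E a v × Chain E v vs b

IsCycle : ∀ {m n} → EdgeSet m n → List (V m n) → Set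
IsCycle E [] = ⊥
IsCycle E (v ∷ vs) = 2 ≤ length vs × Unique (v ∷ vs) × Chain E v vs v

IsForest : ∀ {m n} → EdgeSet m n → Set
IsForest {m} {n} E = ¬ Σ (List (V m n)) (IsCycle E)

Connected : ∀ {m n} → EdgeSet m n → V m n → V m n → Set
Connected E = Star (Adj E)

-- The graph has exactly k connected components: a surjective labelling of
-- vertices by Fin k whose fibres are exactly the connected components.
HasComponents : ∀ {m n} → EdgeSet m n → ℕ → Set
HasComponents {m} {n} E k =
  Σ (V m n → Fin k) λ c →
    (∀ i → ∃ λ u → c u ≡ i) × (∀ u v → (c u ≡ c v) ⇔ Connected E u v)

ForestK : ∀ {m n} → ℕ → EdgeSet m n → Set
ForestK k E = IsForest E × HasComponents E k

InP : ∀ {m' n'} → ℕ → EdgeSet (suc (suc m')) (suc (suc n')) → Set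
InP k E = ForestK k E × HasEdge E zero zero × HasEdge E zero (suc zero)

InQ : ∀ {m' n'} → ℕ → EdgeSet (suc (suc m')) (suc (suc n')) → Set
InQ k E = ForestK k E × HasEdge E zero zero × HasEdge E (suc zero) zero

InR : ∀ {m' n'} → ℕ → EdgeSet (suc (suc m')) (suc (suc n')) → Set
InR k E = ForestK k E × HasEdge E zero zero × HasEdge E (suc zero) (suc zero)

-- L is a duplicate-free enumeration of the set {E | S E}; then #S = length L.
Enumerates : ∀ {m n} → List (EdgeSet m n) → (EdgeSet m n → Set) → Set
Enumerates {m} {n} L S = Unique L × (∀ (E : EdgeSet m n) → (E ∈ L) ⇔ S E)

-- For F ∈ R, deleting the edge {2,2̄} leaves a forest H with k + 1 components in which 2 and 2̄
-- are disconnected. If 1 and 2̄ are disconnected in H, then H + {1,2̄} ∈ P; otherwise 2 and 1̄ are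
-- disconnected in H (else 2 ~ 1̄ ~ 1 ~ 2̄), and H + {2,1̄} ∈ Q. Moving the new edge back to {2,2̄}
-- recovers F, so R splits into two parts that inject into P and Q. No forest in the image in P
-- contains {2,2̄}, but since k ≤ m + n − 3 some forest in P does: extend {1,1̄}, {1,2̄}, {2,2̄}
-- greedily by edges joining different components.

module Submission where

open import Defs
open import Level using (0ℓ)
open import Data.Nat using (ℕ; zero; suc; _+_; _∸_; _≤_; _<_; z≤n; s≤s; s≤s⁻¹)
open import Data.Nat.Properties using (suc-injective; +-suc; +-comm; +-mono-≤-<; m∸n+n≡m; m≤n⇒m≤o+n; module ≤-Reasoning)
open import Data.Bool using (Bool; true; false)
open import Data.Bool.Properties using (¬-not) renaming (_≟_ to _≟ᵇ_)
open import Data.Fin using (Fin; zero; suc; punchIn; punchOut; join; splitAt)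
open import Data.Fin.Properties using (_≟_; 0≢1+n; punchOut-injective; punchOut-cong; punchOut-punchIn; punchInᵢ≢i; splitAt-join; join-splitAt)
import Data.Fin.Properties as Fin
open import Data.Vec using (Vec; lookup; tabulate; updateAt; _[_]≔_; replicate)
open import Data.Vec.Properties using (lookup∘updateAt; lookup∘updateAt′; tabulate∘lookup; tabulate-cong; lookup-replicate)
open import Data.List using (List; []; _∷_; _++_; length; map; filter; cartesianProduct; allFin; InitLast; initLast; _∷ʳ′_)
open import Data.List.Properties using (length-++-sucʳ; length-map; map-∘; map-id-local)
open import Data.List.Membership.Propositional using (_∈_; _∉_; find; lose)
open import Data.List.Membership.Propositional.Properties using (∈-∃++; ∈-++⁺ˡ; ∈-++⁺ʳ; ∈-++⁻; ∈-map⁺; ∈-map⁻; ∈-filter⁺; ∈-filter⁻; ∈-cartesianProduct⁺; ∈-allFin)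
open import Data.List.Relation.Binary.Subset.Propositional using (_⊆_)
open import Data.List.Relation.Binary.Permutation.Propositional using (↭⇒↭ₛ)
open import Data.List.Relation.Binary.Permutation.Propositional.Properties using (++-comm; ↭-length)
open import Data.List.Relation.Binary.Permutation.Setoid.Properties using (Unique-resp-↭)
open import Data.List.Relation.Unary.Any using (Any; here; there)
open import Data.List.Relation.Unary.All as All using (All; []; _∷_)
open import Data.List.Relation.Unary.All.Properties using (¬Any⇒All¬; ++⁻ˡ; ++⁻ʳ)
open import Data.List.Relation.Unary.AllPairs using ([]; _∷_)
open import Data.List.Relation.Unary.Unique.Propositional using (Unique)
import Data.List.Relation.Unary.Unique.Propositional.Properties as Unique
open import Data.Product using (Σ; ∃; ∃₂; _×_; _,_; proj₁; proj₂)
open import Data.Product.Properties using () renaming (≡-dec to ×-≡-dec)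
open import Data.Sum using (_⊎_; inj₁; inj₂)
open import Data.Sum.Properties using () renaming (≡-dec to ⊎-≡-dec)
open import Function using (_∘_)
open import Function.Bundles using (mk⇔; Equivalence)
open import Relation.Binary using (Rel; DecidableEquality)
open import Relation.Binary.PropositionalEquality
open import Relation.Binary.Construct.Closure.ReflexiveTransitive using (Star; ε; _◅_; _◅◅_)
import Relation.Binary.Construct.Closure.ReflexiveTransitive as Star
open import Relation.Nullary using (¬_; Dec; yes; no; contradiction)
open import Relation.Nullary.Decidable using (_⊎-dec_; _×-dec_; map′)
open import Relation.Unary using (Pred; Decidable)
open import Relation.Unary.Properties using (∁?)

open Equivalence using (to; from)

-- Counting duplicate-free lists

module _ {A : Set} where

  ∈-removeMiddle : ∀ {x z : A} ys zs → z ∈ ys ++ x ∷ zs → z ≢ x → z ∈ ys ++ zs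
  ∈-removeMiddle ys zs z∈ z≢x with ∈-++⁻ ys z∈
  ... | inj₁ z∈ys         = ∈-++⁺ˡ z∈ys
  ... | inj₂ (here z≡x)   = contradiction z≡x z≢x
  ... | inj₂ (there z∈zs) = ∈-++⁺ʳ ys z∈zs

  unique-⊆⇒length≤ : ∀ {xs ys : List A} → Unique xs → xs ⊆ ys → length xs ≤ length ys
  unique-⊆⇒length≤ {[]}     _               _    = z≤n
  unique-⊆⇒length≤ {x ∷ xs} (x∉xs ∷ uxs) xs⊆ys with ∈-∃++ (xs⊆ys (here refl))
  ... | ys , zs , refl = subst (suc (length xs) ≤_) (sym (length-++-sucʳ ys x zs))
          (s≤s (unique-⊆⇒length≤ uxs λ z∈xs →
            ∈-removeMiddle ys zs (xs⊆ys (there z∈xs)) λ z≡x → All.lookup x∉xs z∈xs (sym z≡x)))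

  unique-⊂⇒length< : ∀ {xs ys : List A} {w} → Unique xs → xs ⊆ ys → w ∈ ys → w ∉ xs →
                     length xs < length ys
  unique-⊂⇒length< {xs} uxs xs⊆ys w∈ys w∉xs =
    unique-⊆⇒length≤ (¬Any⇒All¬ xs w∉xs ∷ uxs) λ { (here refl) → w∈ys ; (there z∈xs) → xs⊆ys z∈xs }

  length-filter-∁ : ∀ {P : Pred A 0ℓ} (P? : Decidable P) xs →
                    length (filter P? xs) + length (filter (∁? P?) xs) ≡ length xs
  length-filter-∁ P? [] = refl
  length-filter-∁ P? (x ∷ xs) with P? x
  ... | yes _ = cong suc (length-filter-∁ P? xs)
  ... | no _  = trans (+-suc _ _) (cong suc (length-filter-∁ P? xs))

module _ {A B : Set} (f : A → B) (g : B → A) {xs : List A} {ys : List B} (uxs : Unique xs)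
         (f-into : ∀ {x} → x ∈ xs → f x ∈ ys) (g∘f-id : ∀ {x} → x ∈ xs → g (f x) ≡ x) where

  private
    map-unique : Unique (map f xs)
    map-unique = Unique.map⁻ {f = g} (subst Unique (sym g∘f-xs) uxs)
      where
      g∘f-xs : map g (map f xs) ≡ xs
      g∘f-xs = trans (sym (map-∘ xs)) (map-id-local (All.tabulate g∘f-id))

    map⊆ : map f xs ⊆ ys
    map⊆ y∈ with ∈-map⁻ f y∈
    ... | x , x∈xs , refl = f-into x∈xs

  retraction⇒length≤ : length xs ≤ length ys
  retraction⇒length≤ = subst (_≤ length ys) (length-map f xs) (unique-⊆⇒length≤ map-unique map⊆)

  retraction⇒length< : ∀ {w} → w ∈ ys → (∀ {x} → x ∈ xs → f x ≢ w) → length xs < length ys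
  retraction⇒length< w∈ys f≢w = subst (_< length ys) (length-map f xs)
    (unique-⊂⇒length< map-unique map⊆ w∈ys λ w∈ → let x , x∈xs , w≡fx = ∈-map⁻ f w∈ in f≢w x∈xs (sym w≡fx))

-- Reachability

module _ {V : Set} where

  Joins : V → V → Rel V 0ℓ
  Joins a b p q = (p ≡ a × q ≡ b) ⊎ (p ≡ b × q ≡ a)

  module OneMoreEdge (R R⁺ : Rel V 0ℓ) (a b : V)
    (R⁺⇒R⊎ab : ∀ {p q} → R⁺ p q → R p q ⊎ Joins a b p q) (R⇒R⁺ : ∀ {p q} → R p q → R⁺ p q)
    (R⁺ab : R⁺ a b) (R⁺ba : R⁺ b a) where

    ThroughEdge : Rel V 0ℓ
    ThroughEdge u v = Star R u v ⊎ (Star R u a × Star R b v) ⊎ (Star R u b × Star R a v)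

    private
      prepend : ∀ {x y z} → R⁺ x y → ThroughEdge y z → ThroughEdge x z
      prepend r t with R⁺⇒R⊎ab r
      prepend r (inj₁ w)                   | inj₁ s = inj₁ (s ◅ w)
      prepend r (inj₂ (inj₁ (w₁ , w₂)))    | inj₁ s = inj₂ (inj₁ (s ◅ w₁ , w₂))
      prepend r (inj₂ (inj₂ (w₁ , w₂)))    | inj₁ s = inj₂ (inj₂ (s ◅ w₁ , w₂))
      prepend r (inj₁ w)                   | inj₂ (inj₁ (refl , refl)) = inj₂ (inj₁ (ε , w))
      prepend r (inj₂ (inj₁ (_ , w₂)))     | inj₂ (inj₁ (refl , refl)) = inj₂ (inj₁ (ε , w₂))
      prepend r (inj₂ (inj₂ (_ , w₂)))     | inj₂ (inj₁ (refl , refl)) = inj₁ w₂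
      prepend r (inj₁ w)                   | inj₂ (inj₂ (refl , refl)) = inj₂ (inj₂ (ε , w))
      prepend r (inj₂ (inj₁ (_ , w₂)))     | inj₂ (inj₂ (refl , refl)) = inj₁ w₂
      prepend r (inj₂ (inj₂ (_ , w₂)))     | inj₂ (inj₂ (refl , refl)) = inj₂ (inj₂ (ε , w₂))

    lift : ∀ {u v} → Star R u v → Star R⁺ u v
    lift ε       = ε
    lift (r ◅ w) = R⇒R⁺ r ◅ lift w

    Star⁺⇒ThroughEdge : ∀ {u v} → Star R⁺ u v → ThroughEdge u v
    Star⁺⇒ThroughEdge ε       = inj₁ ε
    Star⁺⇒ThroughEdge (r ◅ w) = prepend r (Star⁺⇒ThroughEdge w)

    ThroughEdge⇒Star⁺ : ∀ {u v} → ThroughEdge u v → Star R⁺ u v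
    ThroughEdge⇒Star⁺ (inj₁ w)                = lift w
    ThroughEdge⇒Star⁺ (inj₂ (inj₁ (w₁ , w₂))) = lift w₁ ◅◅ R⁺ab ◅ lift w₂
    ThroughEdge⇒Star⁺ (inj₂ (inj₂ (w₁ , w₂))) = lift w₁ ◅◅ R⁺ba ◅ lift w₂

  Linked : List (V × V) → Rel V 0ℓ
  Linked es p q = Any (λ (a , b) → Joins a b p q) es

  Linked-∷⁻ : ∀ {a b es p q} → Linked ((a , b) ∷ es) p q → Linked es p q ⊎ Joins a b p q
  Linked-∷⁻ (here ab) = inj₂ ab
  Linked-∷⁻ (there l) = inj₁ l

  module _ (_≟_ : DecidableEquality V) where

    Star-Linked? : ∀ es u v → Dec (Star (Linked es) u v)
    Star-Linked? [] u v with u ≟ v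
    ... | yes refl = yes ε
    ... | no u≢v   = no λ { ε → u≢v refl ; (() ◅ _) }
    Star-Linked? ((a , b) ∷ es) u v =
      map′ ThroughEdge⇒Star⁺ Star⁺⇒ThroughEdge
        (u ⇝? v ⊎-dec (u ⇝? a ×-dec b ⇝? v) ⊎-dec (u ⇝? b ×-dec a ⇝? v))
      where
      open OneMoreEdge (Linked es) (Linked ((a , b) ∷ es)) a b Linked-∷⁻ there
             (here (inj₁ (refl , refl))) (here (inj₂ (refl , refl)))
      _⇝?_ : ∀ x y → Dec (Star (Linked es) x y)
      x ⇝? y = Star-Linked? es x y

  module _ {R : Rel V 0ℓ} where

    vertices : ∀ {a b} → Star R a b → List V
    vertices ε                 = []
    vertices (_◅_ {j = c} _ w) = c ∷ vertices w

    private
      dropUntil : ∀ {a c b} (w : Star R c b) → a ∈ c ∷ vertices w → Unique (c ∷ vertices w) →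
                  Σ (Star R a b) λ w′ → Unique (a ∷ vertices w′)
      dropUntil w       (here refl) u       = w , u
      dropUntil (_ ◅ w) (there a∈w) (_ ∷ u) = dropUntil w a∈w u

    module _ (_≟_ : DecidableEquality V) where

      open import Data.List.Membership.DecPropositional _≟_ using (_∈?_)

      eraseLoops : ∀ {a b} → Star R a b → Σ (Star R a b) λ w → Unique (a ∷ vertices w)
      eraseLoops ε = ε , [] ∷ []
      eraseLoops {a} (r ◅ w) with eraseLoops w
      ... | w′ , u with a ∈? (_ ∷ vertices w′)
      ... | yes a∈w′ = dropUntil w′ a∈w′ u
      ... | no  a∉w′ = r ◅ w′ , ¬Any⇒All¬ _ a∉w′ ∷ u

variable
  m n : ℕ

Edge : ℕ → ℕ → Set
Edge m n = Fin m × Fin n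

_≟ₑ_ : DecidableEquality (Edge m n)
_≟ₑ_ = ×-≡-dec _≟_ _≟_

entry : EdgeSet m n → Edge m n → Bool
entry E (x , y) = lookup (lookup E x) y

Has : EdgeSet m n → Edge m n → Set
Has E (x , y) = HasEdge E x y

-- Opaque so that concrete edge sets are never normalised: all reasoning goes through the
-- lemmas on entries.
opaque
  setEdge : EdgeSet m n → Edge m n → Bool → EdgeSet m n
  setEdge E (x , y) b = updateAt E x (_[ y ]≔ b)

  entry-setEdge : ∀ (E : EdgeSet m n) e b → entry (setEdge E e b) e ≡ b
  entry-setEdge E (x , y) b = trans (cong (λ row → lookup row y) (lookup∘updateAt x E))
                                    (lookup∘updateAt y (lookup E x))

  entry-setEdge-≢ : ∀ (E : EdgeSet m n) {e d} b → d ≢ e → entry (setEdge E e b) d ≡ entry E d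
  entry-setEdge-≢ E {x , y} {i , j} b d≢e with i ≟ x
  ... | no i≢x = cong (λ row → lookup row j) (lookup∘updateAt′ i x i≢x E)
  ... | yes refl with j ≟ y
  ...   | yes refl = contradiction refl d≢e
  ...   | no j≢y   = trans (cong (λ row → lookup row j) (lookup∘updateAt x E))
                           (lookup∘updateAt′ j y j≢y (lookup E x))

addEdge delEdge : EdgeSet m n → Edge m n → EdgeSet m n
addEdge E e = setEdge E e true
delEdge E e = setEdge E e false

moveEdge : EdgeSet m n → Edge m n → Edge m n → EdgeSet m n
moveEdge E e e′ = addEdge (delEdge E e) e′

entry-≗⇒≡ : ∀ {E E′ : EdgeSet m n} → (∀ e → entry E e ≡ entry E′ e) → E ≡ E′
entry-≗⇒≡ {E = E} {E′} eq = lookup-≗⇒≡ λ x → lookup-≗⇒≡ λ y → eq (x , y)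
  where
  lookup-≗⇒≡ : ∀ {A : Set} {k} {xs ys : Vec A k} → (∀ i → lookup xs i ≡ lookup ys i) → xs ≡ ys
  lookup-≗⇒≡ {xs = xs} {ys} eq = trans (sym (tabulate∘lookup xs)) (trans (tabulate-cong eq) (tabulate∘lookup ys))

moveEdge-involutive : ∀ (E : EdgeSet m n) {e e′} → e ≢ e′ → Has E e → ¬ Has E e′ →
                      moveEdge (moveEdge E e e′) e′ e ≡ E
moveEdge-involutive E {e} {e′} e≢e′ has ¬has = entry-≗⇒≡ pointwise
  where
  F = moveEdge E e e′
  pointwise : ∀ d → entry (moveEdge F e′ e) d ≡ entry E d
  pointwise d with d ≟ₑ e | d ≟ₑ e′
  ... | yes refl | _ = trans (entry-setEdge (delEdge F e′) e true) (sym has)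
  ... | no d≢e | yes refl = begin
      entry (moveEdge F d e) d ≡⟨ entry-setEdge-≢ (delEdge F d) true d≢e ⟩
      entry (delEdge F d) d    ≡⟨ entry-setEdge F d false ⟩
      false                    ≡⟨ sym (¬-not ¬has) ⟩
      entry E d                ∎
    where open ≡-Reasoning
  ... | no d≢e | no d≢e′ = begin
      entry (moveEdge F e′ e) d ≡⟨ entry-setEdge-≢ (delEdge F e′) true d≢e ⟩
      entry (delEdge F e′) d    ≡⟨ entry-setEdge-≢ F false d≢e′ ⟩
      entry F d                 ≡⟨ entry-setEdge-≢ (delEdge E e) true d≢e′ ⟩
      entry (delEdge E e) d     ≡⟨ entry-setEdge-≢ E false d≢e ⟩
      entry E d                 ∎
    where open ≡-Reasoning

_≟ᵥ_ : DecidableEquality (V m n)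
_≟ᵥ_ = ⊎-≡-dec _≟_ _≟_

Ends : Edge m n → Rel (V m n) 0ℓ
Ends (x , y) = Joins (inj₁ x) (inj₂ y)

module _ {E : EdgeSet m n} where

  Adj⇒Has : ∀ {p q} → Adj E p q → ∃ λ d → Has E d × Ends d p q
  Adj⇒Has {inj₁ x} {inj₂ y} a = (x , y) , a , inj₁ (refl , refl)
  Adj⇒Has {inj₂ y} {inj₁ x} a = (x , y) , a , inj₂ (refl , refl)

  Has⇒Adj : ∀ {d p q} → Has E d → Ends d p q → Adj E p q
  Has⇒Adj h (inj₁ (refl , refl)) = h
  Has⇒Adj h (inj₂ (refl , refl)) = h

  Adj-sym : ∀ {p q} → Adj E p q → Adj E q p
  Adj-sym {inj₁ _} {inj₂ _} a = a
  Adj-sym {inj₂ _} {inj₁ _} a = a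

  Connected-sym : ∀ {u v} → Connected E u v → Connected E v u
  Connected-sym = Star.reverse Adj-sym

Adj-map : ∀ {E E′ : EdgeSet m n} → (∀ {d} → Has E d → Has E′ d) → ∀ {p q} → Adj E p q → Adj E′ p q
Adj-map f a = let d , h , ends = Adj⇒Has a in Has⇒Adj (f h) ends

module _ (E : EdgeSet m n) (e : Edge m n) where

  Has-addEdge-new : Has (addEdge E e) e
  Has-addEdge-new = entry-setEdge E e true

  ¬Has-delEdge : ¬ Has (delEdge E e) e
  ¬Has-delEdge h with trans (sym (entry-setEdge E e false)) h
  ... | ()

  Has-setEdge-≢⁻ : ∀ {d} b → d ≢ e → Has (setEdge E e b) d → Has E d
  Has-setEdge-≢⁻ b d≢e h = trans (sym (entry-setEdge-≢ E b d≢e)) h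

  Has-setEdge-≢⁺ : ∀ {d} b → d ≢ e → Has E d → Has (setEdge E e b) d
  Has-setEdge-≢⁺ b d≢e h = trans (entry-setEdge-≢ E b d≢e) h

  Has-addEdge⁺ : ∀ {d} → Has E d → Has (addEdge E e) d
  Has-addEdge⁺ {d} h with d ≟ₑ e
  ... | yes refl = Has-addEdge-new
  ... | no d≢e   = Has-setEdge-≢⁺ true d≢e h

  Has-delEdge⁻ : ∀ {d} → Has (delEdge E e) d → Has E d
  Has-delEdge⁻ {d} h with d ≟ₑ e
  ... | yes refl = contradiction h ¬Has-delEdge
  ... | no d≢e   = Has-setEdge-≢⁻ false d≢e h

  Adj-addEdge⁻ : ∀ {p q} → Adj (addEdge E e) p q → Adj E p q ⊎ Ends e p q
  Adj-addEdge⁻ a with Adj⇒Has a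
  ... | d , h , ends with d ≟ₑ e
  ...   | yes refl = inj₂ ends
  ...   | no d≢e   = inj₁ (Has⇒Adj (Has-setEdge-≢⁻ true d≢e h) ends)

  Adj-delEdge⁺ : ∀ {p q} → Adj E p q → Adj (delEdge E e) p q ⊎ Ends e p q
  Adj-delEdge⁺ a with Adj⇒Has a
  ... | d , h , ends with d ≟ₑ e
  ...   | yes refl = inj₂ ends
  ...   | no d≢e   = inj₁ (Has⇒Adj (Has-setEdge-≢⁺ false d≢e h) ends)

endpoints : Edge m n → V m n × V m n
endpoints (x , y) = inj₁ x , inj₂ y

allEdges : List (Edge m n)
allEdges {m} {n} = cartesianProduct (allFin m) (allFin n)

module _ (E : EdgeSet m n) where

  Has? : ∀ d → Dec (Has E d)
  Has? d = entry E d ≟ᵇ true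

  edgeList : List (V m n × V m n)
  edgeList = map endpoints (filter Has? allEdges)

  Adj⇒Linked : ∀ {p q} → Adj E p q → Linked edgeList p q
  Adj⇒Linked a with Adj⇒Has a
  ... | (x , y) , h , ends =
    lose (∈-map⁺ endpoints (∈-filter⁺ Has? (∈-cartesianProduct⁺ (∈-allFin x) (∈-allFin y)) h)) ends

  Linked⇒Adj : ∀ {p q} → Linked edgeList p q → Adj E p q
  Linked⇒Adj l with find l
  ... | _ , e∈ , ends with ∈-map⁻ endpoints e∈
  ...   | d , d∈ , refl = Has⇒Adj (proj₂ (∈-filter⁻ Has? {xs = allEdges} d∈)) ends

  Connected? : ∀ u v → Dec (Connected E u v)
  Connected? u v = map′ (Star.map Linked⇒Adj) (Star.map Adj⇒Linked) (Star-Linked? _≟ᵥ_ edgeList u v)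

-- Forests

module _ {m n : ℕ} where

  open import Data.List.Membership.DecPropositional (_≟ᵥ_ {m} {n}) using (_∈?_)

  module _ {H G : EdgeSet m n} (H⇒G : ∀ {p q} → Adj H p q → Adj G p q) where

    Chain-map : ∀ {u} vs {w} → Chain H u vs w → Chain G u vs w
    Chain-map []       a       = H⇒G a
    Chain-map (v ∷ vs) (a , c) = H⇒G a , Chain-map vs c

    walk⇒Chain : ∀ {a b c} (w : Connected H a b) → Adj G b c → Chain G a (vertices w) c
    walk⇒Chain ε       a′ = a′
    walk⇒Chain (a ◅ w) a′ = H⇒G a , walk⇒Chain w a′

    IsForest-mono : IsForest G → IsForest H
    IsForest-mono noCycle ([] , ())
    IsForest-mono noCycle (v ∷ vs , len , u , c) = noCycle (v ∷ vs , len , u , Chain-map vs c)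

  Chain-map-avoiding : ∀ {G H : EdgeSet m n} X → (∀ {p q} → X ≢ p → X ≢ q → Adj G p q → Adj H p q) →
                       ∀ {u} vs {w} → X ≢ u → All (X ≢_) vs → X ≢ w → Chain G u vs w → Chain H u vs w
  Chain-map-avoiding X G⇒H []       X≢u []          X≢w a       = G⇒H X≢u X≢w a
  Chain-map-avoiding X G⇒H (v ∷ vs) X≢u (X≢v ∷ X≢vs) X≢w (a , c) =
    G⇒H X≢u X≢v a , Chain-map-avoiding X G⇒H vs X≢v X≢vs X≢w c

  module _ {E : EdgeSet m n} where

    Chain-++⁻ : ∀ {u} vs z zs {w} → Chain E u (vs ++ z ∷ zs) w → Chain E u vs z × Chain E z zs w
    Chain-++⁻ []       z zs (a , c) = a , c
    Chain-++⁻ (v ∷ vs) z zs (a , c) = let c₁ , c₂ = Chain-++⁻ vs z zs c in (a , c₁) , c₂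

    Chain-++⁺ : ∀ {u} vs z zs {w} → Chain E u vs z → Chain E z zs w → Chain E u (vs ++ z ∷ zs) w
    Chain-++⁺ []       z zs a       c₂ = a , c₂
    Chain-++⁺ (v ∷ vs) z zs (a , c₁) c₂ = a , Chain-++⁺ vs z zs c₁ c₂

    Chain⇒Connected : ∀ {u} vs {w} → Chain E u vs w → Connected E u w
    Chain⇒Connected []       a       = a ◅ ε
    Chain⇒Connected (v ∷ vs) (a , c) = a ◅ Chain⇒Connected vs c

    IsCycle-rotate : ∀ {c vs X} → IsCycle E (c ∷ vs) → X ∈ c ∷ vs → ∃ λ vs′ → IsCycle E (X ∷ vs′)
    IsCycle-rotate cyc (here refl) = _ , cyc
    IsCycle-rotate {c} (len , u , chain) (there X∈vs) with ∈-∃++ X∈vs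
    ... | pre , post , refl =
      post ++ c ∷ pre ,
      subst (2 ≤_) (suc-injective (↭-length swap)) len ,
      Unique-resp-↭ (setoid (V m n)) (↭⇒↭ₛ swap) u ,
      Chain-++⁺ post c pre c₂ c₁
      where
      swap = ++-comm (c ∷ pre) (_ ∷ post)
      c₁c₂ = Chain-++⁻ pre _ post chain
      c₁ = proj₁ c₁c₂
      c₂ = proj₂ c₁c₂

  module _ (F : EdgeSet m n) (x : Fin m) (y : Fin n) where

    IsForest-delEdge : IsForest F → IsForest (delEdge F (x , y))
    IsForest-delEdge = IsForest-mono (Adj-map (Has-delEdge⁻ F (x , y)))

    IsForest⇒delEdge-disconnects : IsForest F → HasEdge F x y →
                                   ¬ Connected (delEdge F (x , y)) (inj₁ x) (inj₂ y)
    IsForest⇒delEdge-disconnects noCycle h w with eraseLoops _≟ᵥ_ w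
    ... | a ◅ ε , _ = ¬Has-delEdge F (x , y) a
    ... | w′@(_ ◅ _ ◅ _) , u =
      noCycle (inj₁ x ∷ vertices w′ , s≤s (s≤s z≤n) , u ,
               walk⇒Chain (Adj-map (Has-delEdge⁻ F (x , y))) w′ h)

  module _ {H : EdgeSet m n} {x : Fin m} {y : Fin n}
           (x≁y : ¬ Connected H (inj₁ x) (inj₂ y)) where

    private
      G : EdgeSet m n
      G = addEdge H (x , y)
      X : V m n
      X = inj₁ x

    connected-neighbours-are-old : ∀ {v z} → Adj G X v → Adj G z X → v ≢ z → Connected H v z →
                                   Adj H X v × Adj H z X
    connected-neighbours-are-old {v} {z} aᵥ a_z v≢z w
      with Adj-addEdge⁻ H (x , y) {X} {v} aᵥ | Adj-addEdge⁻ H (x , y) {z} {X} a_z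
    ... | inj₁ bᵥ                | inj₁ b_z               = bᵥ , b_z
    ... | inj₁ bᵥ                | inj₂ (inj₂ (refl , _)) = contradiction (bᵥ ◅ w) x≁y
    ... | inj₂ (inj₁ (_ , refl)) | inj₁ b_z               = contradiction (Connected-sym (w ◅◅ b_z ◅ ε)) x≁y
    ... | inj₂ (inj₁ (_ , refl)) | inj₂ (inj₂ (refl , _)) = contradiction refl v≢z
    ... | inj₂ (inj₂ (() , _))   | _
    ... | _                      | inj₂ (inj₁ (_ , ()))

    private
      avoid-x : ∀ {p q} → X ≢ p → X ≢ q → Adj G p q → Adj H p q
      avoid-x {p} {q} X≢p X≢q a with Adj-addEdge⁻ H (x , y) {p = p} {q = q} a
      ... | inj₁ b                   = b
      ... | inj₂ (inj₁ (refl , _))  = contradiction refl X≢p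
      ... | inj₂ (inj₂ (_ , refl))  = contradiction refl X≢q

      noCycleThrough-x : IsForest H → ∀ {vs} → ¬ IsCycle G (X ∷ vs)
      noCycleThrough-x noCycle {v ∷ rest} cyc = go (initLast rest) cyc
        where
        go : InitLast rest → ¬ IsCycle G (X ∷ v ∷ rest)
        go [] (s≤s () , _)
        go (init ∷ʳ′ z) (len , u@((X≢v ∷ X∉rest) ∷ (v∉rest ∷ _)) , aᵥ , chain) =
          noCycle (X ∷ v ∷ init ++ z ∷ [] , len , u , bᵥ , Chain-++⁺ init z [] chainH b_z)
          where
          split = Chain-++⁻ init z [] chain
          chainH = Chain-map-avoiding X avoid-x init X≢v (++⁻ˡ init X∉rest)
                     (All.head (++⁻ʳ init X∉rest)) (proj₁ split)
          old = connected-neighbours-are-old aᵥ (proj₂ split) (All.head (++⁻ʳ init v∉rest))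
                  (Chain⇒Connected init chainH)
          bᵥ = proj₁ old
          b_z = proj₂ old

    IsForest-addEdge : IsForest H → IsForest G
    IsForest-addEdge noCycle ([] , ())
    IsForest-addEdge noCycle (c ∷ vs , cyc@(len , u , chain)) with X ∈? c ∷ vs
    ... | yes X∈ = let _ , cyc′ = IsCycle-rotate cyc X∈ in noCycleThrough-x noCycle cyc′
    ... | no X∉ with ¬Any⇒All¬ _ X∉
    ...   | X≢c ∷ X∉vs = noCycle (c ∷ vs , len , u , Chain-map-avoiding X avoid-x vs X≢c X∉vs X≢c chain)

-- Components

module Merge {k : ℕ} {i j : Fin (suc k)} (i≢j : i ≢ j) where

  merge : Fin (suc k) → Fin k
  merge l with l ≟ i
  ... | yes _  = punchOut i≢j
  ... | no l≢i = punchOut (l≢i ∘ sym)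

  merge-i≡merge-j : merge i ≡ merge j
  merge-i≡merge-j with i ≟ i | j ≟ i
  ... | no i≢i | _       = contradiction refl i≢i
  ... | _      | yes j≡i = contradiction (sym j≡i) i≢j
  ... | yes _  | no _    = punchOut-cong i refl

  merge-punchIn : ∀ t → merge (punchIn i t) ≡ t
  merge-punchIn t with punchIn i t ≟ i
  ... | yes eq = contradiction eq (punchInᵢ≢i i t)
  ... | no _   = trans (punchOut-cong i refl) (punchOut-punchIn i)

  merge-≡⁻ : ∀ {l l′} → merge l ≡ merge l′ → l ≡ l′ ⊎ Joins i j l l′
  merge-≡⁻ {l} {l′} eq with l ≟ i | l′ ≟ i
  ... | yes l≡i | yes l′≡i = inj₁ (trans l≡i (sym l′≡i))
  ... | yes l≡i | no l′≢i  = inj₂ (inj₁ (l≡i , sym (punchOut-injective i≢j (l′≢i ∘ sym) eq)))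
  ... | no l≢i  | yes l′≡i = inj₂ (inj₂ (punchOut-injective (l≢i ∘ sym) i≢j eq , l′≡i))
  ... | no l≢i  | no l′≢i  = inj₁ (punchOut-injective (l≢i ∘ sym) (l′≢i ∘ sym) eq)

module _ {m n : ℕ} where

  module _ {F : EdgeSet m n} {x : Fin m} {y : Fin n} (noCycle : IsForest F) (h : HasEdge F x y) where

    private
      H : EdgeSet m n
      H = delEdge F (x , y)
      a b : V m n
      a = inj₁ x
      b = inj₂ y
      a≁b : ¬ Connected H a b
      a≁b = IsForest⇒delEdge-disconnects F x y noCycle h
      open OneMoreEdge (Adj H) (Adj F) a b (Adj-delEdge⁺ F (x , y)) (Adj-map (Has-delEdge⁻ F (x , y))) h h

    HasComponents-delEdge : ∀ {k} → HasComponents F k → HasComponents H (suc k)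
    HasComponents-delEdge {k} (c , c-onto , c≡⇔) =
      label , label-onto , λ u v → mk⇔ (label≡⇒Connected u v) (Connected⇒label≡ u v)
      where
      label : V m n → Fin (suc k)
      label u with Connected? H u b
      ... | yes _ = zero
      ... | no _  = suc (c u)

      label-connected : ∀ {u} → Connected H u b → label u ≡ zero
      label-connected {u} u~b with Connected? H u b
      ... | yes _   = refl
      ... | no u≁b  = contradiction u~b u≁b

      label-disconnected : ∀ {u} → ¬ Connected H u b → label u ≡ suc (c u)
      label-disconnected {u} u≁b with Connected? H u b
      ... | yes u~b = contradiction u~b u≁b
      ... | no _    = refl

      label-onto : ∀ l → ∃ λ u → label u ≡ l
      label-onto zero = b , label-connected ε
      label-onto (suc l) with c-onto l
      ... | u , cu≡l with Connected? H u b
      ...   | no u≁b  = u , trans (label-disconnected u≁b) (cong suc cu≡l)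
      ...   | yes u~b = a , trans (label-disconnected a≁b) (cong suc (begin
                c a ≡⟨ from (c≡⇔ a b) (h ◅ ε) ⟩
                c b ≡⟨ from (c≡⇔ b u) (lift (Connected-sym u~b)) ⟩
                c u ≡⟨ cu≡l ⟩
                l   ∎))
        where open ≡-Reasoning

      label≡⇒Connected : ∀ u v → label u ≡ label v → Connected H u v
      label≡⇒Connected u v eq with Connected? H u b | Connected? H v b
      ... | yes u~b | yes v~b = u~b ◅◅ Connected-sym v~b
      ... | yes _   | no _    = contradiction eq 0≢1+n
      ... | no _    | yes _   = contradiction (sym eq) 0≢1+n
      ... | no u≁b  | no v≁b with Star⁺⇒ThroughEdge (to (c≡⇔ u v) (Fin.suc-injective eq))
      ...   | inj₁ u~v               = u~v
      ...   | inj₂ (inj₁ (_ , b~v))  = contradiction (Connected-sym b~v) v≁b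
      ...   | inj₂ (inj₂ (u~b , _))  = contradiction u~b u≁b

      Connected⇒label≡ : ∀ u v → Connected H u v → label u ≡ label v
      Connected⇒label≡ u v u~v with Connected? H u b | Connected? H v b
      ... | yes _   | yes _   = refl
      ... | yes u~b | no v≁b  = contradiction (Connected-sym u~v ◅◅ u~b) v≁b
      ... | no u≁b  | yes v~b = contradiction (u~v ◅◅ v~b) u≁b
      ... | no _    | no _    = cong suc (from (c≡⇔ u v) (lift u~v))

  module _ {H : EdgeSet m n} {x : Fin m} {y : Fin n} (x≁y : ¬ Connected H (inj₁ x) (inj₂ y)) where

    private
      G : EdgeSet m n
      G = addEdge H (x , y)
      a b : V m n
      a = inj₁ x
      b = inj₂ y
      open OneMoreEdge (Adj H) (Adj G) a b (Adj-addEdge⁻ H (x , y)) (Adj-map (Has-addEdge⁺ H (x , y)))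
                       (Has-addEdge-new H (x , y)) (Has-addEdge-new H (x , y))

    HasComponents-addEdge : ∀ {k} → HasComponents H (suc k) → HasComponents G k
    HasComponents-addEdge (c , c-onto , c≡⇔) =
      merge ∘ c , label-onto , λ u v → mk⇔ (label≡⇒Connected u v) (Connected⇒label≡ u v)
      where
      ca≢cb : c a ≢ c b
      ca≢cb eq = x≁y (to (c≡⇔ a b) eq)
      open Merge ca≢cb

      label-onto : ∀ t → ∃ λ u → merge (c u) ≡ t
      label-onto t = let u , cu≡ = c-onto (punchIn (c a) t) in u , trans (cong merge cu≡) (merge-punchIn t)

      label≡⇒Connected : ∀ u v → merge (c u) ≡ merge (c v) → Connected G u v
      label≡⇒Connected u v eq with merge-≡⁻ eq
      ... | inj₁ cu≡cv               = lift (to (c≡⇔ u v) cu≡cv)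
      ... | inj₂ (inj₁ (cu≡ca , cv≡cb)) =
        ThroughEdge⇒Star⁺ (inj₂ (inj₁ (to (c≡⇔ u a) cu≡ca , to (c≡⇔ b v) (sym cv≡cb))))
      ... | inj₂ (inj₂ (cu≡cb , cv≡ca)) =
        ThroughEdge⇒Star⁺ (inj₂ (inj₂ (to (c≡⇔ u b) cu≡cb , to (c≡⇔ a v) (sym cv≡ca))))

      Connected⇒label≡ : ∀ u v → Connected G u v → merge (c u) ≡ merge (c v)
      Connected⇒label≡ u v u~v with Star⁺⇒ThroughEdge u~v
      ... | inj₁ u~v′ = cong merge (from (c≡⇔ u v) u~v′)
      ... | inj₂ (inj₁ (u~a , b~v)) = begin
        merge (c u) ≡⟨ cong merge (from (c≡⇔ u a) u~a) ⟩
        merge (c a) ≡⟨ merge-i≡merge-j ⟩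
        merge (c b) ≡⟨ cong merge (from (c≡⇔ b v) b~v) ⟩
        merge (c v) ∎
        where open ≡-Reasoning
      ... | inj₂ (inj₂ (u~b , a~v)) = begin
        merge (c u) ≡⟨ cong merge (from (c≡⇔ u b) u~b) ⟩
        merge (c b) ≡⟨ merge-i≡merge-j ⟨
        merge (c a) ≡⟨ cong merge (from (c≡⇔ a v) a~v) ⟩
        merge (c v) ∎
        where open ≡-Reasoning

-- Building forests

module _ {m n : ℕ} where

  ForestK-delEdge : ∀ {k F x y} → ForestK k F → HasEdge F x y → ForestK (suc k) (delEdge {m} {n} F (x , y))
  ForestK-delEdge {F = F} {x} {y} (noCycle , comps) h =
    IsForest-delEdge F x y noCycle , HasComponents-delEdge noCycle h comps

  ForestK-addEdge : ∀ {k H x y} → ForestK (suc k) H → ¬ Connected H (inj₁ x) (inj₂ y) →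
                    ForestK k (addEdge {m} {n} H (x , y))
  ForestK-addEdge (noCycle , comps) x≁y = IsForest-addEdge x≁y noCycle , HasComponents-addEdge x≁y comps

  Isolated : EdgeSet m n → V m n → Set
  Isolated E v = ∀ {w} → ¬ Adj E v w

  isolated-unreachable : ∀ {E v w} → Isolated E v → Connected E v w → v ≡ w
  isolated-unreachable iso ε       = refl
  isolated-unreachable iso (a ◅ _) = contradiction a iso

  isolated⇒disconnectedˡ : ∀ {E x} y → Isolated E (inj₁ x) → ¬ Connected E (inj₁ x) (inj₂ y)
  isolated⇒disconnectedˡ _ iso w with isolated-unreachable iso w
  ... | ()

  isolated⇒disconnectedʳ : ∀ {E} x {y} → Isolated E (inj₂ y) → ¬ Connected E (inj₁ x) (inj₂ y)
  isolated⇒disconnectedʳ _ iso w with isolated-unreachable iso (Connected-sym w)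
  ... | ()

  Isolated-addEdge : ∀ {E v} x y → v ≢ inj₁ x → v ≢ inj₂ y → Isolated E v → Isolated (addEdge E (x , y)) v
  Isolated-addEdge {E} x y v≢x v≢y iso a with Adj-addEdge⁻ E (x , y) a
  ... | inj₁ a′              = iso a′
  ... | inj₂ (inj₁ (v≡x , _)) = v≢x v≡x
  ... | inj₂ (inj₂ (v≡y , _)) = v≢y v≡y

  opaque
    noEdges : EdgeSet m n
    noEdges = replicate m (replicate n false)

    entry-noEdges : ∀ d → entry noEdges d ≡ false
    entry-noEdges (x , y) = trans (cong (λ row → lookup row y) (lookup-replicate x _)) (lookup-replicate y false)

  Isolated-noEdges : ∀ {v} → Isolated noEdges v
  Isolated-noEdges a with Adj⇒Has a
  ... | d , h , _ with trans (sym h) (entry-noEdges d)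
  ...   | ()

  ForestK-noEdges : ForestK (m + n) noEdges
  ForestK-noEdges =
    noCycle , join m n , (λ l → splitAt m l , join-splitAt m n l) ,
    λ u v → mk⇔ (≡⇒Connected u v) (Connected⇒≡ u v)
    where
    noCycle : IsForest noEdges
    noCycle ([] , ())
    noCycle (_ ∷ []    , _ , _ , a)     = Isolated-noEdges a
    noCycle (_ ∷ _ ∷ _ , _ , _ , a , _) = Isolated-noEdges a
    ≡⇒Connected : ∀ u v → join m n u ≡ join m n v → Connected noEdges u v
    ≡⇒Connected u v eq with trans (sym (splitAt-join m n u)) (trans (cong (splitAt m) eq) (splitAt-join m n v))
    ... | refl = ε
    Connected⇒≡ : ∀ u v → Connected noEdges u v → join m n u ≡ join m n v
    Connected⇒≡ u v u~v = cong (join m n) (isolated-unreachable Isolated-noEdges u~v)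

module _ {m n : ℕ} where

  disconnected-pair : ∀ {G : EdgeSet (suc m) (suc n)} {j} → HasComponents G j → 2 ≤ j →
                      ∃₂ λ x y → ¬ Connected G (inj₁ x) (inj₂ y)
  disconnected-pair {G} (c , c-onto , c≡⇔) (s≤s (s≤s z≤n)) with c (inj₁ zero) ≟ c (inj₂ zero)
  ... | no c₀≢c₀ = zero , zero , λ w → c₀≢c₀ (from (c≡⇔ _ _) w)
  ... | yes c₀≡c₀ = outsider (other-label (c (inj₂ zero)))
    where
    other-label : ∀ l → ∃ λ u → c u ≢ l
    other-label l with c-onto zero | c-onto (suc zero)
    ... | u , cu≡0 | v , cv≡1 with c u ≟ l
    ...   | no cu≢l  = u , cu≢l
    ...   | yes cu≡l = v , λ cv≡l → 0≢1+n (trans (sym cu≡0) (trans cu≡l (trans (sym cv≡l) cv≡1)))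
    outsider : (∃ λ u → c u ≢ c (inj₂ zero)) → ∃₂ λ x y → ¬ Connected G (inj₁ x) (inj₂ y)
    outsider (inj₁ x , cu≢) = x , zero , λ w → cu≢ (from (c≡⇔ _ _) w)
    outsider (inj₂ y , cu≢) = zero , y , λ w → cu≢ (trans (sym (from (c≡⇔ _ _) w)) c₀≡c₀)

  extend-forest : ∀ {G : EdgeSet (suc m) (suc n)} {j k} → ForestK j G → 0 < k → k ≤ j →
                  ∃ λ W → ForestK k W × (∀ {d} → Has G d → Has W d)
  extend-forest {G} {j} {k} fk 0<k k≤j =
    go (j ∸ k) (subst (λ i → ForestK i G) (sym (m∸n+n≡m k≤j)) fk) (λ h → h)
    where
    go : ∀ d {G′} → ForestK (d + k) G′ → (∀ {e} → Has G e → Has G′ e) →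
         ∃ λ W → ForestK k W × (∀ {e} → Has G e → Has W e)
    go zero    fk G⊆G′ = _ , fk , G⊆G′
    go (suc d) {G′} fk G⊆G′ with disconnected-pair (proj₂ fk) (s≤s (m≤n⇒m≤o+n d 0<k))
    ... | x , y , x≁y = go d (ForestK-addEdge fk x≁y) (Has-addEdge⁺ G′ (x , y) ∘ G⊆G′)

-- The injection of R into P ⊎ Q

module _ {m′ n′ : ℕ} where

  private
    M N : ℕ
    M = suc (suc m′)
    N = suc (suc n′)

  e₁₁ e₁₂ e₂₁ e₂₂ : Edge M N
  e₁₁ = zero , zero
  e₁₂ = zero , suc zero
  e₂₁ = suc zero , zero
  e₂₂ = suc zero , suc zero

  private
    E₁ E₂ E₃ : EdgeSet M N
    E₁ = addEdge noEdges e₁₁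
    E₂ = addEdge E₁ e₁₂
    E₃ = addEdge E₂ e₂₂

    E₁-isolates-2̄ : Isolated E₁ (inj₂ (suc zero))
    E₁-isolates-2̄ = Isolated-addEdge zero zero (λ ()) (λ ()) Isolated-noEdges

    E₂-isolates-2 : Isolated E₂ (inj₁ (suc zero))
    E₂-isolates-2 = Isolated-addEdge zero (suc zero) (λ ()) (λ ())
                      (Isolated-addEdge zero zero (λ ()) (λ ()) Isolated-noEdges)

    ForestK-E₁ : ForestK (suc (m′ + N)) E₁
    ForestK-E₁ = ForestK-addEdge ForestK-noEdges (isolated⇒disconnectedˡ zero (Isolated-noEdges {M} {N}))

    ForestK-E₂ : ForestK (suc (m′ + suc n′)) E₂
    ForestK-E₂ = subst (λ j → ForestK j E₂) (+-suc m′ (suc n′))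
                   (ForestK-addEdge ForestK-E₁ (isolated⇒disconnectedʳ zero E₁-isolates-2̄))

    ForestK-E₃ : ForestK (m′ + suc n′) E₃
    ForestK-E₃ = ForestK-addEdge ForestK-E₂ (isolated⇒disconnectedˡ (suc zero) E₂-isolates-2)

    has₁₁ : Has E₃ e₁₁
    has₁₁ = Has-addEdge⁺ E₂ e₂₂ {e₁₁} (Has-addEdge⁺ E₁ e₁₂ {e₁₁} (Has-addEdge-new noEdges e₁₁))

    has₁₂ : Has E₃ e₁₂
    has₁₂ = Has-addEdge⁺ E₂ e₂₂ {e₁₂} (Has-addEdge-new E₁ e₁₂)

    has₂₂ : Has E₃ e₂₂
    has₂₂ = Has-addEdge-new E₂ e₂₂

  witness : ∀ {k} → 0 < k → k ≤ m′ + suc n′ → ∃ λ W → InP k W × Has W e₂₂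
  witness 0<k k≤ =
    let W , fk , E₃⊆W = extend-forest ForestK-E₃ 0<k k≤
    in W , (fk , E₃⊆W {e₁₁} has₁₁ , E₃⊆W {e₁₂} has₁₂) , E₃⊆W {e₂₂} has₂₂

  Split : EdgeSet M N → Set
  Split F = Connected (delEdge F e₂₂) (inj₁ zero) (inj₂ (suc zero))

  Split? : Decidable Split
  Split? F = Connected? (delEdge F e₂₂) (inj₁ zero) (inj₂ (suc zero))

  toP toQ fromP fromQ : EdgeSet M N → EdgeSet M N
  toP F = moveEdge F e₂₂ e₁₂
  toQ F = moveEdge F e₂₂ e₂₁
  fromP G = moveEdge G e₁₂ e₂₂
  fromQ G = moveEdge G e₂₁ e₂₂

  toP-lacks-e₂₂ : ∀ F → ¬ Has (toP F) e₂₂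
  toP-lacks-e₂₂ F h = ¬Has-delEdge F e₂₂ (Has-setEdge-≢⁻ (delEdge F e₂₂) e₁₂ true (λ ()) h)

module _ {m′ n′ k : ℕ} where

  private
    M N : ℕ
    M = suc (suc m′)
    N = suc (suc n′)

  module _ {F : EdgeSet M N} (F∈R : InR k F) where

    private
      fk : ForestK k F
      fk = proj₁ F∈R
      h₁₁ : Has F e₁₁
      h₁₁ = proj₁ (proj₂ F∈R)
      h₂₂ : Has F e₂₂
      h₂₂ = proj₂ (proj₂ F∈R)
      H : EdgeSet M N
      H = delEdge F e₂₂
      keep : ∀ {d} → d ≢ e₂₂ → Has F d → Has H d
      keep d≢e₂₂ = Has-setEdge-≢⁺ F e₂₂ false d≢e₂₂

    InR∧¬Split⇒InP : ¬ Split F → InP k (toP F)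
    InR∧¬Split⇒InP 1≁2̄ = ForestK-addEdge (ForestK-delEdge fk h₂₂) 1≁2̄ ,
                         Has-addEdge⁺ H e₁₂ {e₁₁} (keep (λ ()) h₁₁) , Has-addEdge-new H e₁₂

    Split⇒2≁1̄ : Split F → ¬ Connected H (inj₁ (suc zero)) (inj₂ zero)
    Split⇒2≁1̄ 1~2̄ 2~1̄ = IsForest⇒delEdge-disconnects F (suc zero) (suc zero) (proj₁ fk) h₂₂
                           (2~1̄ ◅◅ keep (λ ()) h₁₁ ◅ 1~2̄)

    InR∧Split⇒InQ : Split F → InQ k (toQ F)
    InR∧Split⇒InQ 1~2̄ = ForestK-addEdge (ForestK-delEdge fk h₂₂) (Split⇒2≁1̄ 1~2̄) ,
                         Has-addEdge⁺ H e₂₁ {e₁₁} (keep (λ ()) h₁₁) , Has-addEdge-new H e₂₁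

    fromP∘toP : ¬ Split F → fromP (toP F) ≡ F
    fromP∘toP 1≁2̄ = moveEdge-involutive F (λ ()) h₂₂ λ h₁₂ → 1≁2̄ (keep (λ ()) h₁₂ ◅ ε)

    fromQ∘toQ : Split F → fromQ (toQ F) ≡ F
    fromQ∘toQ 1~2̄ = moveEdge-involutive F (λ ()) h₂₂ λ h₂₁ → Split⇒2≁1̄ 1~2̄ (keep (λ ()) h₂₁ ◅ ε)

  module _ {LR : List (EdgeSet M N)} (enumR : Enumerates LR (InR k)) where

    private
      uR : Unique LR
      uR = proj₁ enumR
      inR : ∀ {P : EdgeSet M N → Set} (P? : Decidable P) {F} → F ∈ filter P? LR → InR k F × P F
      inR P? F∈ = let F∈LR , pF = ∈-filter⁻ P? F∈ in to (proj₂ enumR _) F∈LR , pF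

    length-Split≤ : ∀ {LQ} → Enumerates LQ (InQ k) → length (filter Split? LR) ≤ length LQ
    length-Split≤ (_ , Q⇔) = retraction⇒length≤ toQ fromQ (Unique.filter⁺ Split? uR)
      (λ F∈ → let r , s = inR Split? F∈ in from (Q⇔ _) (InR∧Split⇒InQ r s))
      (λ F∈ → let r , s = inR Split? F∈ in fromQ∘toQ r s)

    length-¬Split< : ∀ {LP} → 0 < k → k ≤ m′ + suc n′ → Enumerates LP (InP k) →
                     length (filter (∁? Split?) LR) < length LP
    length-¬Split< 0<k k≤ (_ , P⇔) =
      let W , W∈P , W∋e₂₂ = witness 0<k k≤ in
      retraction⇒length< toP fromP (Unique.filter⁺ (∁? Split?) uR)
        (λ F∈ → let r , s = inR (∁? Split?) F∈ in from (P⇔ _) (InR∧¬Split⇒InP r s))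
        (λ F∈ → let r , s = inR (∁? Split?) F∈ in fromP∘toP r s)
        (from (P⇔ W) W∈P)
        (λ {F} _ toPF≡W → toP-lacks-e₂₂ F (subst (λ G → Has G e₂₂) (sym toPF≡W) W∋e₂₂))

k+2<m+n⇒k≤ : ∀ {m′ n′ k} → k + 2 < suc (suc m′) + suc (suc n′) → k ≤ m′ + suc n′
k+2<m+n⇒k≤ {m′} {n′} {k} lt =
  s≤s⁻¹ (subst (suc k ≤_) (+-suc m′ (suc n′)) (s≤s⁻¹ (s≤s⁻¹ (subst (_< suc (suc m′) + suc (suc n′)) (+-comm k 2) lt))))

lemma2p20 : (m' n' k : ℕ) → 0 < k → k + 2 < suc (suc m') + suc (suc n') →
    (LP LQ LR : List (EdgeSet (suc (suc m')) (suc (suc n')))) →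
    Enumerates LP (InP k) → Enumerates LQ (InQ k) → Enumerates LR (InR k) →
    length LR < length LP + length LQ
lemma2p20 m' n' k 0<k k+2<m+n LP LQ LR enumP enumQ enumR = begin-strict
  length LR                                                  ≡⟨ length-filter-∁ Split? LR ⟨
  length (filter Split? LR) + length (filter (∁? Split?) LR) <⟨ +-mono-≤-< (length-Split≤ enumR enumQ)
                                                                  (length-¬Split< enumR 0<k (k+2<m+n⇒k≤ k+2<m+n) enumP) ⟩
  length LQ + length LP                                      ≡⟨ +-comm (length LQ) (length LP) ⟩
  length LP + length LQ                                      ∎
  where open ≤-Reasoning
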